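{- Let $f_1$ be the morphism on $\{0,1,2,3,4\}$ given by $0\mapsto 01$, $1\mapsto 2$, $2\mapsto 34$, $3\mapsto 31$, $4\mapsto 2$, and $g_1$ the coding $0,1,3\mapsto a$, $2,4\mapsto b$. Then $f_1$ is a $\varphi$-morphism, and the infinite word $g_1(f_1^\omega(0))=w_2w_3w_4\cdots$, whose letters are indexed starting from $2$, codes the non-terminal $\mathcal{P}$-positions of $K^1$: for every $n\ge 0$, $a_n$ is the index of the $(n+1)$-th occurrence of the letter $a$ and $b_n$ is the index of the $(n+1)$-th occurrence of the letter $b$ in this word.
   Context: Positions are pairs $(x,y)\in\mathbb{N}^2$; a Wythoff move from $(x,y)$ leads to $(x-i,y)$ ($1\le i\le x$), $(x,y-i)$ ($1\le i\le y$) or $(x-i,y-i)$ ($1\le i\le\min(x,y)$). For $\ell\in\mathbb{N}$, $K^\ell$ is the impartial game with Wythoff moves in which the positions of $\{(x,y):x+y\le\ell\}$ are terminal: no move is allowed from them and a player who moves into one wins (normal play). A $\mathcal{P}$-position is one from which the previous player wins. The non-terminal $\mathcal{P}$-positions $(a,b)$ with $a<b$, listed in increasing order of $a$, are $(a_n,b_n)$, $n\ge0$. $f_1^\omega(0)$ denotes the fixed point of $f_1$ beginning with $0$. Fibonacci representation: $F_0=1,F_1=2,F_{n+2}=F_{n+1}+F_n$; $\mathrm{rep}_F(n)$ is the greedy representation of $n$ over $\{0,1\}$ without consecutive $1$'s ($\mathrm{rep}_F(0)$ empty, regarded as ending with $0$); for a word $u$, $[u]$ denotes the integer it represents. A morphism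 $\mu$ on an alphabet $A$ is a $\varphi$-morphism if its fixed point $\mathbf{w}=w_0w_1\cdots$ satisfies, for every $n$: if $\mathrm{rep}_F(n)$ ends with $1$ then $\mu(w_n)=w_{[\mathrm{rep}_F(n)0]}$, and if it ends with $0$ then $\mu(w_n)=w_{[\mathrm{rep}_F(n)0]}w_{[\mathrm{rep}_F(n)1]}$. -}

module Defs where

open import Data.Nat using (ℕ; zero; suc; _+_; _∸_; _≤_; _<_; _≤?_)
open import Data.Bool using (Bool; true; false; if_then_else_)
open import Data.List using (List; []; _∷_; [_]; _++_; length; filter; map; concatMap; upTo; last)
open import Data.Maybe using (Maybe; just; nothing; fromMaybe)
open import Data.Product using (Σ; _×_; _,_)
open import Data.Sum using (_⊎_)
open import Relation.Nullary using (Dec; yes; no; does)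
open import Relation.Binary.PropositionalEquality using (_≡_; refl)

F : ℕ → ℕ
F zero = 1
F (suc zero) = 2
F (suc (suc n)) = F (suc n) + F n

val : List Bool → ℕ
val [] = 0
val (b ∷ u) = (if b then F (length u) else 0) + val u

-- greedy digits for positions i-1, ..., 0
greedy : ℕ → ℕ → List Bool
greedy zero m = []
greedy (suc i) m with F i ≤? m
... | yes _ = true ∷ greedy i (m ∸ F i)
... | no _ = false ∷ greedy i m

-- number of Fibonacci numbers F i ≤ n (all such i satisfy i < n, since F i ≥ i + 1)
fibLen : ℕ → ℕ
fibLen n = length (filter (λ i → F i ≤? n) (upTo n))

-- rep_F n : the greedy Fibonacci representation (empty for n = 0)
repF : ℕ → List Bool
repF n = greedy (fibLen n) n

-- "rep_F(n) ends with 1" (the empty word counts as ending with 0)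
endsWith1 : List Bool → Bool
endsWith1 u = fromMaybe false (last u)

-- φ-morphisms (w is the fixed point of μ, given as a function ℕ → A)

IsPhiMorphism : {A : Set} → (A → List A) → (ℕ → A) → Set
IsPhiMorphism μ w = ∀ n →
  (endsWith1 (repF n) ≡ true →
     μ (w n) ≡ [ w (val (repF n ++ [ false ])) ])
  × (endsWith1 (repF n) ≡ false →
     μ (w n) ≡ w (val (repF n ++ [ false ])) ∷ w (val (repF n ++ [ true ])) ∷ [])

data L5 : Set where
  c0 c1 c2 c3 c4 : L5

f₁ : L5 → List L5
f₁ c0 = c0 ∷ c1 ∷ []
f₁ c1 = c2 ∷ []
f₁ c2 = c3 ∷ c4 ∷ []
f₁ c3 = c3 ∷ c1 ∷ []
f₁ c4 = c2 ∷ []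

iterF₁ : ℕ → List L5
iterF₁ zero = c0 ∷ []
iterF₁ (suc k) = concatMap f₁ (iterF₁ k)

lookupM : {A : Set} → List A → ℕ → Maybe A
lookupM [] _ = nothing
lookupM (x ∷ xs) zero = just x
lookupM (x ∷ xs) (suc n) = lookupM xs n

-- f₁^ω(0): letter n is letter n of the prefix f₁^(n+1)(0)
-- (which has length > n; the default c0 is never used)
fixF₁ : ℕ → L5
fixF₁ n = fromMaybe c0 (lookupM (iterF₁ (suc n)) n)

data AB : Set where
  a b : AB

_≟AB_ : (x y : AB) → Dec (x ≡ y)
a ≟AB a = yes refl
a ≟AB b = no (λ ())
b ≟AB a = no (λ ())
b ≟AB b = yes refl

g₁ : L5 → AB
g₁ c0 = a
g₁ c1 = a
g₁ c3 = a
g₁ c2 = b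
g₁ c4 = b

-- the word g₁(f₁^ω(0)) = w₂ w₃ w₄ ⋯ , indexed from 2
coded : ℕ → AB
coded i = g₁ (fixF₁ (i ∸ 2))

countBelow : AB → ℕ → ℕ
countBelow c i = length (filter (λ j → coded j ≟AB c) (map (2 +_) (upTo (i ∸ 2))))

IsOcc : AB → ℕ → ℕ → Set
IsOcc c n i = (2 ≤ i) × (coded i ≡ c) × (countBelow c i ≡ n)

data Move (ℓ x y : ℕ) : ℕ → ℕ → Set where
  left  : ∀ i → ℓ < x + y → 1 ≤ i → i ≤ x → Move ℓ x y (x ∸ i) y
  down  : ∀ i → ℓ < x + y → 1 ≤ i → i ≤ y → Move ℓ x y x (y ∸ i)
  diag  : ∀ i → ℓ < x + y → 1 ≤ i → i ≤ x → i ≤ y → Move ℓ x y (x ∸ i) (y ∸ i)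

mutual
  data IsP (ℓ : ℕ) (x y : ℕ) : Set where
    allToN : (∀ x' y' → Move ℓ x y x' y' → IsN ℓ x' y') → IsP ℓ x y

  data IsN (ℓ : ℕ) (x y : ℕ) : Set where
    someToP : ∀ x' y' → Move ℓ x y x' y' → IsP ℓ x' y' → IsN ℓ x y

NonTerminalP : ℕ → ℕ → ℕ → Set
NonTerminalP ℓ x y = (ℓ < x + y) × IsP ℓ x y

ListsPPositions : ℕ → (ℕ → ℕ) → (ℕ → ℕ) → Set
ListsPPositions ℓ A B =
  (∀ n → (A n < B n) × NonTerminalP ℓ (A n) (B n))
  × (∀ x y → x < y → NonTerminalP ℓ x y → Σ ℕ (λ n → (A n ≡ x) × (B n ≡ y)))
  × (∀ n → A n < A (suc n))

{-# OPTIONS --safe #-}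
-- Letter n of f₁^ω(0) is the state that the automaton δ₁ reaches from 0 on rep_F(n),
-- where reading the digit d in state s leads to letter d of f₁ s.  A state has a one-letter
-- image exactly when it is entered by reading a 1, and this is the φ-morphism property.
-- The coding g₁ yields b exactly on the words ending in 10 or 101.  Hence, with u = rep_F(n),
-- the a's sit at the indices a_n = 2 + [α u], where α inserts a 0 before the last digit, and
-- the b's at b_n = 2 + [β u] = a_n + n + 2, where β replaces a final 0 by 010 and a final 1
-- by 101; up to leading zeros every Zeckendorf word is α or β of a Zeckendorf word.  Both
-- sequences increase, so they enumerate the occurrences.  Finally, whenever A increases,
-- B n = A n + n + ℓ + 1 and A, B partition {ℓ+1, ℓ+2, ...}, the terminal positions of K^ℓ
-- together with the pairs (A n, B n) and (B n, A n) admit no move inside and can be entered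
-- from every other position, so they are the P-positions.

module Submission where

open import Defs
open import Data.Bool using (Bool; true; false; if_then_else_; not)
open import Data.List using (List; []; _∷_; [_]; _++_; _∷ʳ_; length; filter; map; upTo; replicate; last; foldl; concatMap)
open import Data.List.Properties
  using (filter-++; filter-accept; filter-reject; length-++; upTo-∷ʳ; foldl-∷ʳ; concatMap-++; ++-identityʳ)
open import Data.List.Reverse using (Reverse; reverseView; []; _∶_∶ʳ_)
open import Data.Maybe using (just; fromMaybe)
open import Data.Nat using (ℕ; zero; suc; _+_; _∸_; _≤_; _<_; _≤′_; _≤?_; _<?_; z≤n; s≤s; ≤′-reflexive; ≤′-step)
open import Data.Nat.Induction using (<-wellFounded)
open import Data.Nat.Properties
open import Data.Nat.Solver using (module +-*-Solver)
open import Data.Product using (Σ; ∃; ∃₂; _×_; _,_)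
open import Data.Sum using (_⊎_; inj₁; inj₂)
open import Function using (_∘′_)
open import Induction.WellFounded using (Acc; acc)
open import Relation.Binary.Definitions using (tri<; tri≈; tri>)
open import Relation.Binary.PropositionalEquality hiding ([_])
open import Relation.Nullary using (¬_; yes; no; does; contradiction)
open import Relation.Unary using (Decidable)
open ≡-Reasoning

-- Fibonacci numeration

F-suc : ∀ k → F (suc k) ≡ F k + F (k ∸ 1)
F-suc zero = refl
F-suc (suc k) = refl

F>0 : ∀ k → 0 < F k
F>0 zero = s≤s z≤n
F>0 (suc zero) = s≤s z≤n
F>0 (suc (suc k)) = ≤-trans (F>0 (suc k)) (m≤m+n _ _)

F-<-suc : ∀ k → F k < F (suc k)
F-<-suc k = subst (F k <_) (sym (F-suc k)) (m<m+n (F k) (F>0 (k ∸ 1)))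

F-mono-≤ : ∀ {i j} → i ≤ j → F i ≤ F j
F-mono-≤ = mono′ ∘′ ≤⇒≤′
  where
  mono′ : ∀ {i j} → i ≤′ j → F i ≤ F j
  mono′ (≤′-reflexive refl) = ≤-refl
  mono′ (≤′-step {n} i≤′j) = ≤-trans (mono′ i≤′j) (<⇒≤ (F-<-suc n))

n<F : ∀ n → n < F n
n<F zero = s≤s z≤n
n<F (suc n) = ≤-<-trans (n<F n) (F-<-suc n)

data Zeckendorf : List Bool → Set where
  []   : Zeckendorf []
  0∷_  : ∀ {u} → Zeckendorf u → Zeckendorf (false ∷ u)
  1∷[] : Zeckendorf (true ∷ [])
  10∷_ : ∀ {u} → Zeckendorf u → Zeckendorf (true ∷ false ∷ u)

val<F : ∀ {u} → Zeckendorf u → val u < F (length u)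
val<F [] = s≤s z≤n
val<F (0∷_ {u} z) = <-≤-trans (val<F z) (<⇒≤ (F-<-suc (length u)))
val<F 1∷[] = s≤s (s≤s z≤n)
val<F (10∷_ {u} z) = +-monoʳ-< (F (suc (length u))) (val<F z)

length-greedy : ∀ k m → length (greedy k m) ≡ k
length-greedy zero m = refl
length-greedy (suc k) m with F k ≤? m
... | yes _ = cong suc (length-greedy k (m ∸ F k))
... | no _ = cong suc (length-greedy k m)

∸F<F : ∀ k m → F k ≤ m → m < F (suc k) → m ∸ F k < F (k ∸ 1)
∸F<F k m Fk≤m m<F = +-cancelˡ-< (F k) (m ∸ F k) (F (k ∸ 1))
  (subst₂ _<_ (sym (m+[n∸m]≡n Fk≤m)) (F-suc k) m<F)

val-greedy : ∀ k m → m < F k → val (greedy k m) ≡ m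
val-greedy zero zero _ = refl
val-greedy zero (suc m) (s≤s ())
val-greedy (suc k) m m<F with F k ≤? m
... | yes Fk≤m = begin
  F (length (greedy k (m ∸ F k))) + val (greedy k (m ∸ F k))
    ≡⟨ cong₂ _+_ (cong F (length-greedy k _))
                 (val-greedy k _ (<-≤-trans (∸F<F k m Fk≤m m<F) (F-mono-≤ (m∸n≤m k 1)))) ⟩
  F k + (m ∸ F k)
    ≡⟨ m+[n∸m]≡n Fk≤m ⟩
  m ∎
... | no Fk≰m = val-greedy k m (≰⇒> Fk≰m)

greedy-< : ∀ k m → m < F k → greedy (suc k) m ≡ false ∷ greedy k m
greedy-< k m m<F with F k ≤? m
... | yes Fk≤m = contradiction Fk≤m (<⇒≱ m<F)
... | no _ = refl

greedy-≥ : ∀ k m → F k ≤ m → greedy (suc k) m ≡ true ∷ greedy k (m ∸ F k)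
greedy-≥ k m Fk≤m with F k ≤? m
... | yes _ = refl
... | no Fk≰m = contradiction Fk≤m Fk≰m

greedy-zeckendorf : ∀ k m → m < F k → Zeckendorf (greedy k m)
greedy-zeckendorf zero m _ = []
greedy-zeckendorf (suc k) m m<F with F k ≤? m
... | no Fk≰m = 0∷ greedy-zeckendorf k m (≰⇒> Fk≰m)
greedy-zeckendorf (suc zero) m m<F | yes _ = 1∷[]
greedy-zeckendorf (suc (suc k)) m m<F | yes Fk≤m
  rewrite greedy-< k (m ∸ F (suc k)) (∸F<F (suc k) m Fk≤m m<F)
  = 10∷ greedy-zeckendorf k _ (∸F<F (suc k) m Fk≤m m<F)

greedy-val : ∀ {u} → Zeckendorf u → greedy (length u) (val u) ≡ u
greedy-val [] = refl
greedy-val (0∷_ {u} z) = begin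
  greedy (suc (length u)) (val u) ≡⟨ greedy-< (length u) (val u) (val<F z) ⟩
  false ∷ greedy (length u) (val u) ≡⟨ cong (false ∷_) (greedy-val z) ⟩
  false ∷ u ∎
greedy-val 1∷[] = refl
greedy-val (10∷_ {u} z) with F (suc (length u)) ≤? F (suc (length u)) + val u
... | no F≰F+v = contradiction (m≤m+n _ _) F≰F+v
... | yes _ = cong (true ∷_) (begin
  greedy (suc (length u)) (F (suc (length u)) + val u ∸ F (suc (length u)))
    ≡⟨ cong (greedy (suc (length u))) (m+n∸m≡n (F (suc (length u))) (val u)) ⟩
  greedy (suc (length u)) (val u)
    ≡⟨ greedy-< (length u) (val u) (val<F z) ⟩
  false ∷ greedy (length u) (val u)
    ≡⟨ cong (false ∷_) (greedy-val z) ⟩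
  false ∷ u ∎)

greedy-+ : ∀ d k m → m < F k → greedy (d + k) m ≡ replicate d false ++ greedy k m
greedy-+ zero k m _ = refl
greedy-+ (suc d) k m m<F = begin
  greedy (suc (d + k)) m ≡⟨ greedy-< (d + k) m (<-≤-trans m<F (F-mono-≤ (m≤n+m k d))) ⟩
  false ∷ greedy (d + k) m ≡⟨ cong (false ∷_) (greedy-+ d k m m<F) ⟩
  false ∷ replicate d false ++ greedy k m ∎

LeadingZerosIrrelevant : {X : Set} → (List Bool → X) → Set
LeadingZerosIrrelevant h = ∀ u → h (false ∷ u) ≡ h u

module _ {X : Set} {h : List Bool → X} (h-0∷ : LeadingZerosIrrelevant h) where

  h-replicate : ∀ d u → h (replicate d false ++ u) ≡ h u
  h-replicate zero u = refl
  h-replicate (suc d) u = trans (h-0∷ _) (h-replicate d u)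

  greedy-length-irrelevant : ∀ k k′ m → m < F k → m < F k′ → h (greedy k m) ≡ h (greedy k′ m)
  greedy-length-irrelevant k k′ m m<Fk m<Fk′ = begin
    h (greedy k m)                          ≡⟨ sym (h-replicate k′ _) ⟩
    h (replicate k′ false ++ greedy k m)    ≡⟨ cong h (sym (greedy-+ k′ k m m<Fk)) ⟩
    h (greedy (k′ + k) m)                   ≡⟨ cong (λ j → h (greedy j m)) (+-comm k′ k) ⟩
    h (greedy (k + k′) m)                   ≡⟨ cong h (greedy-+ k k′ m m<Fk′) ⟩
    h (replicate k false ++ greedy k′ m)    ≡⟨ h-replicate k _ ⟩
    h (greedy k′ m)                         ∎

  zeckendorf-unique : ∀ {u v} → Zeckendorf u → Zeckendorf v → val u ≡ val v → h u ≡ h v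
  zeckendorf-unique {u} {v} zu zv eq = begin
    h u                              ≡⟨ cong h (sym (greedy-val zu)) ⟩
    h (greedy (length u) (val u))    ≡⟨ greedy-length-irrelevant (length u) (length v) (val u)
                                          (val<F zu) (subst (_< F (length v)) (sym eq) (val<F zv)) ⟩
    h (greedy (length v) (val u))    ≡⟨ cong (λ m → h (greedy (length v) m)) eq ⟩
    h (greedy (length v) (val v))    ≡⟨ cong h (greedy-val zv) ⟩
    h v                              ∎

countUpTo : {P : ℕ → Set} → Decidable P → ℕ → ℕ
countUpTo P? k = length (filter P? (upTo k))

module _ {P : ℕ → Set} (P? : Decidable P) where

  private
    countUpTo-suc : ∀ k → countUpTo P? (suc k) ≡ countUpTo P? k + length (filter P? [ k ])
    countUpTo-suc k = begin
      length (filter P? (upTo (suc k)))                ≡⟨ cong (length ∘′ filter P?) (sym (upTo-∷ʳ k)) ⟩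
      length (filter P? (upTo k ++ [ k ]))             ≡⟨ cong length (filter-++ P? (upTo k) [ k ]) ⟩
      length (filter P? (upTo k) ++ filter P? [ k ])   ≡⟨ length-++ (filter P? (upTo k)) ⟩
      countUpTo P? k + length (filter P? [ k ])        ∎

  countUpTo-suc-accept : ∀ {k} → P k → countUpTo P? (suc k) ≡ suc (countUpTo P? k)
  countUpTo-suc-accept {k} pk = begin
    countUpTo P? (suc k)                        ≡⟨ countUpTo-suc k ⟩
    countUpTo P? k + length (filter P? [ k ])   ≡⟨ cong (λ l → countUpTo P? k + length l) (filter-accept P? pk) ⟩
    countUpTo P? k + 1                          ≡⟨ +-comm _ 1 ⟩
    suc (countUpTo P? k)                        ∎

  countUpTo-suc-reject : ∀ {k} → ¬ P k → countUpTo P? (suc k) ≡ countUpTo P? k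
  countUpTo-suc-reject {k} ¬pk = begin
    countUpTo P? (suc k)                        ≡⟨ countUpTo-suc k ⟩
    countUpTo P? k + length (filter P? [ k ])   ≡⟨ cong (λ l → countUpTo P? k + length l) (filter-reject P? ¬pk) ⟩
    countUpTo P? k + 0                          ≡⟨ +-identityʳ _ ⟩
    countUpTo P? k                              ∎

module _ (n : ℕ) where

  private
    F≤n? : Decidable (λ i → F i ≤ n)
    F≤n? i = F i ≤? n

    -- Since F is increasing, the indices counted form an initial segment of ℕ.
    count-invariant : ∀ k → n < F (countUpTo F≤n? k) ⊎ countUpTo F≤n? k ≡ k
    count-invariant zero = inj₂ refl
    count-invariant (suc k) with count-invariant k | F k ≤? n
    ... | inj₁ n<F | yes Fk≤n = inj₁ (<-≤-trans n<F (F-mono-≤ (≤-trans (n≤1+n _)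
                                  (≤-reflexive (sym (countUpTo-suc-accept F≤n? Fk≤n))))))
    ... | inj₁ n<F | no Fk≰n = inj₁ (subst (λ c → n < F c) (sym (countUpTo-suc-reject F≤n? Fk≰n)) n<F)
    ... | inj₂ eq | yes Fk≤n = inj₂ (trans (countUpTo-suc-accept F≤n? Fk≤n) (cong suc eq))
    ... | inj₂ eq | no Fk≰n = inj₁ (subst (λ c → n < F c)
                                 (sym (trans (countUpTo-suc-reject F≤n? Fk≰n) eq)) (≰⇒> Fk≰n))

  n<F[fibLen] : n < F (fibLen n)
  n<F[fibLen] with count-invariant n
  ... | inj₁ n<F[count] = n<F[count]
  ... | inj₂ count≡n = subst (λ t → n < F t) (sym count≡n) (n<F n)

repF-zeckendorf : ∀ n → Zeckendorf (repF n)
repF-zeckendorf n = greedy-zeckendorf (fibLen n) n (n<F[fibLen] n)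

val-repF : ∀ n → val (repF n) ≡ n
val-repF n = val-greedy (fibLen n) n (n<F[fibLen] n)

last-∷ʳ : {A : Set} (xs : List A) (x : A) → last (xs ∷ʳ x) ≡ just x
last-∷ʳ [] x = refl
last-∷ʳ (y ∷ []) x = refl
last-∷ʳ (y ∷ z ∷ xs) x = last-∷ʳ (z ∷ xs) x

endsWith1-∷ʳ : ∀ u d → endsWith1 (u ∷ʳ d) ≡ d
endsWith1-∷ʳ u d = cong (fromMaybe false) (last-∷ʳ u d)

zeckendorf-∷ʳ⁻ : ∀ u {d} → Zeckendorf (u ∷ʳ d) → Zeckendorf u
zeckendorf-∷ʳ⁻ [] _ = []
zeckendorf-∷ʳ⁻ (false ∷ u) (0∷ z) = 0∷ zeckendorf-∷ʳ⁻ u z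
zeckendorf-∷ʳ⁻ (true ∷ []) _ = 1∷[]
zeckendorf-∷ʳ⁻ (true ∷ false ∷ u) (10∷ z) = 10∷ zeckendorf-∷ʳ⁻ u z

zeckendorf-∷ʳ-false : ∀ {u} → Zeckendorf u → Zeckendorf (u ∷ʳ false)
zeckendorf-∷ʳ-false [] = 0∷ []
zeckendorf-∷ʳ-false (0∷ z) = 0∷ zeckendorf-∷ʳ-false z
zeckendorf-∷ʳ-false 1∷[] = 10∷ []
zeckendorf-∷ʳ-false (10∷ z) = 10∷ zeckendorf-∷ʳ-false z

zeckendorf-∷ʳ-01 : ∀ u → Zeckendorf (u ∷ʳ false) → Zeckendorf (u ∷ʳ false ∷ʳ true)
zeckendorf-∷ʳ-01 [] _ = 0∷ 1∷[]
zeckendorf-∷ʳ-01 (false ∷ u) (0∷ z) = 0∷ zeckendorf-∷ʳ-01 u z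
zeckendorf-∷ʳ-01 (true ∷ []) _ = 10∷ 1∷[]
zeckendorf-∷ʳ-01 (true ∷ false ∷ u) (10∷ z) = 10∷ zeckendorf-∷ʳ-01 u z

zeckendorf-∷ʳ-11 : ∀ u → ¬ Zeckendorf (u ∷ʳ true ∷ʳ true)
zeckendorf-∷ʳ-11 (false ∷ u) (0∷ z) = zeckendorf-∷ʳ-11 u z
zeckendorf-∷ʳ-11 (true ∷ false ∷ u) (10∷ z) = zeckendorf-∷ʳ-11 u z

zeckendorf-∷ʳ-true : ∀ {u} → Zeckendorf u → endsWith1 u ≡ false → Zeckendorf (u ∷ʳ true)
zeckendorf-∷ʳ-true {u} z ends0 with reverseView u
... | [] = 1∷[]
... | v ∶ _ ∶ʳ false = zeckendorf-∷ʳ-01 v z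
... | v ∶ _ ∶ʳ true = contradiction (trans (sym (endsWith1-∷ʳ v true)) ends0) λ ()

zeckendorf-∷ʳ-true⁻ : ∀ u → Zeckendorf (u ∷ʳ true) → endsWith1 u ≡ false
zeckendorf-∷ʳ-true⁻ u z with reverseView u
... | [] = refl
... | v ∶ _ ∶ʳ false = endsWith1-∷ʳ v false
... | v ∶ _ ∶ʳ true = contradiction z (zeckendorf-∷ʳ-11 v)

-- Automatic words in Fibonacci numeration

lookupM-++ˡ : {A : Set} (xs ys : List A) {m : ℕ} → m < length xs → lookupM (xs ++ ys) m ≡ lookupM xs m
lookupM-++ˡ (x ∷ xs) ys {zero} _ = refl
lookupM-++ˡ (x ∷ xs) ys {suc m} (s≤s m<n) = lookupM-++ˡ xs ys m<n

lookupM-++ʳ : {A : Set} (xs ys : List A) {m : ℕ} → length xs ≤ m →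
              lookupM (xs ++ ys) m ≡ lookupM ys (m ∸ length xs)
lookupM-++ʳ [] ys _ = refl
lookupM-++ʳ (x ∷ xs) ys {suc m} (s≤s n≤m) = lookupM-++ʳ xs ys n≤m

module FibonacciAutomaton {A : Set} (μ : A → List A) (δ : A → Bool → A) (one? : A → Bool)
  (μ-δ : ∀ s → μ s ≡ δ s false ∷ (if one? s then [] else [ δ s true ]))
  (one?-δ : ∀ s d → one? (δ s d) ≡ d) where

  run : A → List Bool → A
  run = foldl δ

  run-∷ʳ : ∀ s u d → run s (u ∷ʳ d) ≡ δ (run s u) d
  run-∷ʳ s u d = foldl-∷ʳ δ s d u

  run-∷ʳ² : ∀ s u d e → run s (u ∷ʳ d ∷ʳ e) ≡ δ (δ (run s u) d) e
  run-∷ʳ² s u d e = trans (run-∷ʳ s (u ∷ʳ d) e) (cong (λ t → δ t e) (run-∷ʳ s u d))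

  iterate : ℕ → List A → List A
  iterate zero xs = xs
  iterate (suc k) xs = concatMap μ (iterate k xs)

  iterate-++ : ∀ k xs ys → iterate k (xs ++ ys) ≡ iterate k xs ++ iterate k ys
  iterate-++ zero xs ys = refl
  iterate-++ (suc k) xs ys = begin
    concatMap μ (iterate k (xs ++ ys))                  ≡⟨ cong (concatMap μ) (iterate-++ k xs ys) ⟩
    concatMap μ (iterate k xs ++ iterate k ys)          ≡⟨ concatMap-++ μ (iterate k xs) (iterate k ys) ⟩
    concatMap μ (iterate k xs) ++ concatMap μ (iterate k ys) ∎

  iterate-suc : ∀ k s → iterate (suc k) [ s ] ≡ iterate k (μ s)
  iterate-suc zero s = ++-identityʳ (μ s)
  iterate-suc (suc k) s = cong (concatMap μ) (iterate-suc k s)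

  iterate-suc-short : ∀ k {s} → one? s ≡ true → iterate (suc k) [ s ] ≡ iterate k [ δ s false ]
  iterate-suc-short k {s} short rewrite iterate-suc k s | μ-δ s | short = refl

  iterate-suc-long : ∀ k {s} → one? s ≡ false →
                     iterate (suc k) [ s ] ≡ iterate k [ δ s false ] ++ iterate k [ δ s true ]
  iterate-suc-long k {s} long rewrite iterate-suc k s | μ-δ s | long = iterate-++ k [ δ s false ] [ δ s true ]

  width : ℕ → A → ℕ
  width k s = if one? s then F (k ∸ 1) else F k

  width-δ-false : ∀ k s → width k (δ s false) ≡ F k
  width-δ-false k s rewrite one?-δ s false = refl

  width-δ-true : ∀ k s → width k (δ s true) ≡ F (k ∸ 1)
  width-δ-true k s rewrite one?-δ s true = refl

  length-iterate : ∀ k s → length (iterate k [ s ]) ≡ width k s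
  length-iterate zero s with one? s
  ... | true = refl
  ... | false = refl
  length-iterate (suc k) s with one? s in eq
  ... | true = begin
    length (iterate (suc k) [ s ])        ≡⟨ cong length (iterate-suc-short k eq) ⟩
    length (iterate k [ δ s false ])      ≡⟨ length-iterate k (δ s false) ⟩
    width k (δ s false)                   ≡⟨ width-δ-false k s ⟩
    F k                                   ∎
  ... | false = begin
    length (iterate (suc k) [ s ])                              ≡⟨ cong length (iterate-suc-long k eq) ⟩
    length (iterate k [ δ s false ] ++ iterate k [ δ s true ])  ≡⟨ length-++ (iterate k [ δ s false ]) ⟩
    length (iterate k [ δ s false ]) + length (iterate k [ δ s true ])
      ≡⟨ cong₂ _+_ (trans (length-iterate k _) (width-δ-false k s))
                   (trans (length-iterate k _) (width-δ-true k s)) ⟩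
    F k + F (k ∸ 1)                                             ≡⟨ sym (F-suc k) ⟩
    F (suc k)                                                   ∎

  length-iterate-δ-false : ∀ k s → length (iterate k [ δ s false ]) ≡ F k
  length-iterate-δ-false k s = trans (length-iterate k (δ s false)) (width-δ-false k s)

  lookup-iterate : ∀ k s m → m < width k s → lookupM (iterate k [ s ]) m ≡ just (run s (greedy k m))
  lookup-iterate-δ-false : ∀ k s m → m < F k →
                           lookupM (iterate k [ δ s false ]) m ≡ just (run s (greedy (suc k) m))
  lookup-iterate-δ-true : ∀ k s m → F k ≤ m → m < F (suc k) →
                          lookupM (iterate k [ δ s true ]) (m ∸ F k) ≡ just (run s (greedy (suc k) m))

  lookup-iterate zero s zero _ = refl
  lookup-iterate zero s (suc m) m<w with one? s
  lookup-iterate zero s (suc m) (s≤s ()) | true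
  lookup-iterate zero s (suc m) (s≤s ()) | false
  lookup-iterate (suc k) s m m<w with one? s in eq | m <? F k
  ... | true | yes m<Fk =
    trans (cong (λ xs → lookupM xs m) (iterate-suc-short k eq)) (lookup-iterate-δ-false k s m m<Fk)
  ... | true | no m≮Fk = contradiction m<w m≮Fk
  ... | false | yes m<Fk = begin
    lookupM (iterate (suc k) [ s ]) m
      ≡⟨ cong (λ xs → lookupM xs m) (iterate-suc-long k eq) ⟩
    lookupM (iterate k [ δ s false ] ++ iterate k [ δ s true ]) m
      ≡⟨ lookupM-++ˡ (iterate k [ δ s false ]) _ (subst (m <_) (sym (length-iterate-δ-false k s)) m<Fk) ⟩
    lookupM (iterate k [ δ s false ]) m
      ≡⟨ lookup-iterate-δ-false k s m m<Fk ⟩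
    just (run s (greedy (suc k) m)) ∎
  ... | false | no m≮Fk = begin
    lookupM (iterate (suc k) [ s ]) m
      ≡⟨ cong (λ xs → lookupM xs m) (iterate-suc-long k eq) ⟩
    lookupM (iterate k [ δ s false ] ++ iterate k [ δ s true ]) m
      ≡⟨ lookupM-++ʳ (iterate k [ δ s false ]) _ (subst (_≤ m) (sym (length-iterate-δ-false k s)) (≮⇒≥ m≮Fk)) ⟩
    lookupM (iterate k [ δ s true ]) (m ∸ length (iterate k [ δ s false ]))
      ≡⟨ cong (λ i → lookupM (iterate k [ δ s true ]) (m ∸ i)) (length-iterate-δ-false k s) ⟩
    lookupM (iterate k [ δ s true ]) (m ∸ F k)
      ≡⟨ lookup-iterate-δ-true k s m (≮⇒≥ m≮Fk) m<w ⟩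
    just (run s (greedy (suc k) m)) ∎

  lookup-iterate-δ-false k s m m<Fk = begin
    lookupM (iterate k [ δ s false ]) m
      ≡⟨ lookup-iterate k (δ s false) m (subst (m <_) (sym (width-δ-false k s)) m<Fk) ⟩
    just (run s (false ∷ greedy k m))
      ≡⟨ cong (just ∘′ run s) (sym (greedy-< k m m<Fk)) ⟩
    just (run s (greedy (suc k) m)) ∎

  lookup-iterate-δ-true k s m Fk≤m m<F = begin
    lookupM (iterate k [ δ s true ]) (m ∸ F k)
      ≡⟨ lookup-iterate k (δ s true) (m ∸ F k) (subst (m ∸ F k <_) (sym (width-δ-true k s)) (∸F<F k m Fk≤m m<F)) ⟩
    just (run s (true ∷ greedy k (m ∸ F k)))
      ≡⟨ cong (just ∘′ run s) (sym (greedy-≥ k m Fk≤m)) ⟩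
    just (run s (greedy (suc k) m)) ∎

  fixedPoint : A → ℕ → A
  fixedPoint s₀ n = fromMaybe s₀ (lookupM (iterate (suc n) [ s₀ ]) n)

  Generates : A → (ℕ → A) → Set
  Generates s₀ w = ∀ {u} → Zeckendorf u → w (val u) ≡ run s₀ u

  module _ {s₀ : A} (δ-s₀ : δ s₀ false ≡ s₀) (one?-s₀ : one? s₀ ≡ false) where

    fixedPoint-generates : Generates s₀ (fixedPoint s₀)
    fixedPoint-generates {u} z = begin
      fromMaybe s₀ (lookupM (iterate (suc m) [ s₀ ]) m)
        ≡⟨ cong (fromMaybe s₀) (lookup-iterate (suc m) s₀ m m<w) ⟩
      run s₀ (greedy (suc m) m)
        ≡⟨ zeckendorf-unique run-0∷ (greedy-zeckendorf (suc m) m m<F) z (val-greedy (suc m) m m<F) ⟩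
      run s₀ u ∎
      where
      m = val u
      m<F : m < F (suc m)
      m<F = <-trans (n<F m) (F-<-suc m)
      m<w : m < width (suc m) s₀
      m<w rewrite one?-s₀ = m<F
      run-0∷ : LeadingZerosIrrelevant (run s₀)
      run-0∷ u = cong (λ s → run s u) δ-s₀

    one?-run : ∀ u → one? (run s₀ u) ≡ endsWith1 u
    one?-run u with reverseView u
    ... | [] = one?-s₀
    ... | v ∶ _ ∶ʳ d = begin
      one? (run s₀ (v ∷ʳ d))   ≡⟨ cong one? (run-∷ʳ s₀ v d) ⟩
      one? (δ (run s₀ v) d)    ≡⟨ one?-δ (run s₀ v) d ⟩
      d                        ≡⟨ sym (endsWith1-∷ʳ v d) ⟩
      endsWith1 (v ∷ʳ d)       ∎

    generates⇒isPhiMorphism : ∀ {w} → Generates s₀ w → IsPhiMorphism μ w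
    generates⇒isPhiMorphism {w} gen n = short , long
      where
      u = repF n
      t = run s₀ u
      w-n : w n ≡ t
      w-n = trans (cong w (sym (val-repF n))) (gen (repF-zeckendorf n))
      w-∷ʳ : ∀ {d} → Zeckendorf (u ∷ʳ d) → w (val (u ∷ʳ d)) ≡ δ t d
      w-∷ʳ {d} z = trans (gen z) (run-∷ʳ s₀ u d)
      w-∷ʳ-false : w (val (u ∷ʳ false)) ≡ δ t false
      w-∷ʳ-false = w-∷ʳ (zeckendorf-∷ʳ-false (repF-zeckendorf n))
      μ-t : ∀ {b} → one? t ≡ b → μ t ≡ δ t false ∷ (if b then [] else [ δ t true ])
      μ-t refl = μ-δ t

      short : endsWith1 u ≡ true → μ (w n) ≡ [ w (val (u ∷ʳ false)) ]
      short ends1 = begin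
        μ (w n)                ≡⟨ cong μ w-n ⟩
        μ t                    ≡⟨ μ-t (trans (one?-run u) ends1) ⟩
        [ δ t false ]          ≡⟨ cong [_] (sym w-∷ʳ-false) ⟩
        [ w (val (u ∷ʳ false)) ] ∎

      long : endsWith1 u ≡ false →
             μ (w n) ≡ w (val (u ∷ʳ false)) ∷ w (val (u ∷ʳ true)) ∷ []
      long ends0 = begin
        μ (w n)                       ≡⟨ cong μ w-n ⟩
        μ t                           ≡⟨ μ-t (trans (one?-run u) ends0) ⟩
        δ t false ∷ δ t true ∷ []     ≡⟨ cong₂ (λ x y → x ∷ y ∷ []) (sym w-∷ʳ-false)
                                           (sym (w-∷ʳ (zeckendorf-∷ʳ-true (repF-zeckendorf n) ends0))) ⟩
        w (val (u ∷ʳ false)) ∷ w (val (u ∷ʳ true)) ∷ [] ∎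

module StrictlyIncreasing {f : ℕ → ℕ} (f-< : ∀ n → f n < f (suc n)) where

  mono-< : ∀ {m n} → m < n → f m < f n
  mono-< {m} m<n = go (≤⇒≤′ m<n)
    where
    go : ∀ {n} → suc m ≤′ n → f m < f n
    go (≤′-reflexive refl) = f-< m
    go (≤′-step {n} p) = <-trans (go p) (f-< n)

  cancel-< : ∀ {m n} → f m < f n → m < n
  cancel-< fm<fn = ≰⇒> λ n≤m → <⇒≱ fm<fn (mono-≤ n≤m)
    where
    mono-≤ : ∀ {m n} → m ≤ n → f m ≤ f n
    mono-≤ m≤n with m≤n⇒m<n∨m≡n m≤n
    ... | inj₁ m<n = <⇒≤ (mono-< m<n)
    ... | inj₂ refl = ≤-refl

  injective : ∀ {m n} → f m ≡ f n → m ≡ n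
  injective {m} {n} eq with <-cmp m n
  ... | tri< m<n _ _ = contradiction eq (<⇒≢ (mono-< m<n))
  ... | tri≈ _ m≡n _ = m≡n
  ... | tri> _ _ n<m = contradiction (sym eq) (<⇒≢ (mono-< n<m))

module _ {P : ℕ → Set} (P? : Decidable P) {e : ℕ → ℕ} (e-< : ∀ n → e n < e (suc n))
         (P-e : ∀ n → P (e n)) (e-onto : ∀ {m} → P m → ∃ λ n → e n ≡ m) where

  open StrictlyIncreasing e-<

  private
    count-between : ∀ k n → (∀ {j} → j < n → e j < k) → k ≤ e n → countUpTo P? k ≡ n
    count-between zero zero _ _ = refl
    count-between zero (suc n) below _ = contradiction (below (n<1+n n)) λ ()
    count-between (suc k) n below k<en with P? k
    ... | no ¬pk = trans (countUpTo-suc-reject P? ¬pk) (count-between k n below′ (<⇒≤ k<en))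
      where
      below′ : ∀ {j} → j < n → e j < k
      below′ j<n with m≤n⇒m<n∨m≡n (≤-pred (below j<n))
      ... | inj₁ ej<k = ej<k
      ... | inj₂ ej≡k = contradiction (subst P ej≡k (P-e _)) ¬pk
    ... | yes pk with e-onto pk
    ...   | j , ej≡k = begin
      countUpTo P? (suc k)                ≡⟨ countUpTo-suc-accept P? pk ⟩
      suc (countUpTo P? k)                ≡⟨ cong suc (count-between k j below-j (≤-reflexive (sym ej≡k))) ⟩
      suc j                               ≡⟨ ≤-antisym j<n (≮⇒≥ 1+j≮n) ⟩
      n                                   ∎
      where
      below-j : ∀ {i} → i < j → e i < k
      below-j i<j = subst (e _ <_) ej≡k (mono-< i<j)
      j<n : j < n
      j<n = cancel-< (subst (_< e n) (sym ej≡k) k<en)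
      1+j≮n : ¬ suc j < n
      1+j≮n 1+j<n = <⇒≱ (subst (_< e (suc j)) ej≡k (e-< j)) (≤-pred (below 1+j<n))

  count-enumeration : ∀ n → countUpTo P? (e n) ≡ n
  count-enumeration n = count-between (e n) n mono-< ≤-refl

length-filter-map : {A B : Set} {P : B → Set} (P? : Decidable P) (f : A → B) (xs : List A) →
                    length (filter P? (map f xs)) ≡ length (filter (λ x → P? (f x)) xs)
length-filter-map P? f [] = refl
length-filter-map P? f (x ∷ xs) with does (P? (f x))
... | true = cong suc (length-filter-map P? f xs)
... | false = length-filter-map P? f xs

-- The game K^ℓ

move-nonterminal : ∀ {ℓ x y x′ y′} → Move ℓ x y x′ y′ → ℓ < x + y
move-nonterminal (left _ nt _ _) = nt
move-nonterminal (down _ nt _ _) = nt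
move-nonterminal (diag _ nt _ _ _) = nt

∸-<-self : ∀ {x i} → 1 ≤ i → i ≤ x → x ∸ i < x
∸-<-self {x} 1≤i i≤x = ∸-monoʳ-< {x} 1≤i i≤x

move-decreasing : ∀ {ℓ x y x′ y′} → Move ℓ x y x′ y′ → x′ + y′ < x + y
move-decreasing {y = y} (left _ _ 1≤i i≤x) = +-monoˡ-< y (∸-<-self 1≤i i≤x)
move-decreasing {x = x} (down _ _ 1≤i i≤y) = +-monoʳ-< x (∸-<-self 1≤i i≤y)
move-decreasing (diag _ _ 1≤i i≤x i≤y) = +-mono-< (∸-<-self 1≤i i≤x) (∸-<-self 1≤i i≤y)

move-swap : ∀ {ℓ x y x′ y′} → Move ℓ x y x′ y′ → Move ℓ y x y′ x′
move-swap {ℓ} {x} {y} (left i nt 1≤i i≤x) = down i (subst (ℓ <_) (+-comm x y) nt) 1≤i i≤x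
move-swap {ℓ} {x} {y} (down i nt 1≤i i≤y) = left i (subst (ℓ <_) (+-comm x y) nt) 1≤i i≤y
move-swap {ℓ} {x} {y} (diag i nt 1≤i i≤x i≤y) = diag i (subst (ℓ <_) (+-comm x y) nt) 1≤i i≤y i≤x

IsP⇒¬IsN : ∀ {ℓ x y} → IsP ℓ x y → ¬ IsN ℓ x y
IsP⇒¬IsN (allToN toN) (someToP x′ y′ mv p′) = IsP⇒¬IsN p′ (toN x′ y′ mv)

module Kernel {ℓ : ℕ} (S : ℕ → ℕ → Set)
  (S-stable : ∀ {x y x′ y′} → S x y → Move ℓ x y x′ y′ → ¬ S x′ y′)
  (S-or-move : ∀ x y → S x y ⊎ ∃₂ λ x′ y′ → Move ℓ x y x′ y′ × S x′ y′) where

  private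
    S⇒IsP′ : ∀ {x y} → Acc _<_ (x + y) → S x y → IsP ℓ x y
    ¬S⇒IsN′ : ∀ {x y} → Acc _<_ (x + y) → ¬ S x y → IsN ℓ x y

    S⇒IsP′ (acc rs) s = allToN λ x′ y′ mv → ¬S⇒IsN′ (rs (move-decreasing mv)) (S-stable s mv)

    ¬S⇒IsN′ {x} {y} (acc rs) ¬s with S-or-move x y
    ... | inj₁ s = contradiction s ¬s
    ... | inj₂ (x′ , y′ , mv , s′) = someToP x′ y′ mv (S⇒IsP′ (rs (move-decreasing mv)) s′)

  S⇒IsP : ∀ {x y} → S x y → IsP ℓ x y
  S⇒IsP = S⇒IsP′ (<-wellFounded _)

  IsP⇒S : ∀ {x y} → IsP ℓ x y → S x y
  IsP⇒S {x} {y} (allToN toN) with S-or-move x y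
  ... | inj₁ s = s
  ... | inj₂ (x′ , y′ , mv , s′) = contradiction (toN x′ y′ mv) (IsP⇒¬IsN (S⇒IsP s′))

record WythoffPair (ℓ : ℕ) (A B : ℕ → ℕ) : Set where
  field
    A-<       : ∀ n → A n < A (suc n)
    ℓ<A       : ∀ n → ℓ < A n
    B≡A+n+ℓ+1 : ∀ n → B n ≡ A n + (n + suc ℓ)
    A≢B       : ∀ m n → A m ≢ B n
    A⊎B       : ∀ m → ℓ < m → (∃ λ n → A n ≡ m) ⊎ (∃ λ n → B n ≡ m)

module _ {ℓ : ℕ} {A B : ℕ → ℕ} (W : WythoffPair ℓ A B) where
  open WythoffPair W

  A<B : ∀ n → A n < B n
  A<B n = subst (A n <_) (sym (B≡A+n+ℓ+1 n)) (m<m+n (A n) (≤-trans (s≤s z≤n) (m≤n+m (suc ℓ) n)))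

  B-< : ∀ n → B n < B (suc n)
  B-< n = subst₂ _<_ (sym (B≡A+n+ℓ+1 n)) (sym (B≡A+n+ℓ+1 (suc n)))
            (+-mono-< (A-< n) (s≤s (≤-refl {n + suc ℓ})))

  private
    module A = StrictlyIncreasing A-<
    module B = StrictlyIncreasing B-<

  WythoffSet : ℕ → ℕ → Set
  WythoffSet x y = x + y ≤ ℓ ⊎ (∃ λ n → A n ≡ x × B n ≡ y) ⊎ (∃ λ n → B n ≡ x × A n ≡ y)

  WythoffSet-swap : ∀ {x y} → WythoffSet x y → WythoffSet y x
  WythoffSet-swap {x} {y} (inj₁ t) = inj₁ (subst (_≤ ℓ) (+-comm x y) t)
  WythoffSet-swap (inj₂ (inj₁ (n , p , q))) = inj₂ (inj₂ (n , q , p))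
  WythoffSet-swap (inj₂ (inj₂ (n , p , q))) = inj₂ (inj₁ (n , q , p))

  private
    ℓ<B : ∀ n → ℓ < B n
    ℓ<B n = <-trans (ℓ<A n) (A<B n)

    stable-AB : ∀ n {x′ y′} → Move ℓ (A n) (B n) x′ y′ → ¬ WythoffSet x′ y′
    stable-AB n (left i _ 1≤i i≤A) (inj₁ t) = <⇒≱ (ℓ<B n) (≤-trans (m≤n+m (B n) _) t)
    stable-AB n (left i _ 1≤i i≤A) (inj₂ (inj₁ (m , Am≡ , Bm≡Bn))) =
      <-irrefl (trans (sym Am≡) (cong A (B.injective Bm≡Bn))) (∸-<-self 1≤i i≤A)
    stable-AB n (left i _ 1≤i i≤A) (inj₂ (inj₂ (m , _ , Am≡Bn))) = A≢B m n Am≡Bn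
    stable-AB n (down i _ 1≤i i≤B) (inj₁ t) = <⇒≱ (ℓ<A n) (≤-trans (m≤m+n (A n) _) t)
    stable-AB n (down i _ 1≤i i≤B) (inj₂ (inj₁ (m , Am≡An , Bm≡))) =
      <-irrefl (trans (sym Bm≡) (cong B (A.injective Am≡An))) (∸-<-self 1≤i i≤B)
    stable-AB n (down i _ 1≤i i≤B) (inj₂ (inj₂ (m , Bm≡An , _))) = A≢B n m (sym Bm≡An)
    stable-AB n (diag i _ 1≤i i≤A i≤B) = diagonal
      where
      x′ = A n ∸ i
      y′≡ : B n ∸ i ≡ x′ + (n + suc ℓ)
      y′≡ = trans (cong (_∸ i) (B≡A+n+ℓ+1 n)) (+-∸-comm (n + suc ℓ) i≤A)
      diagonal : ¬ WythoffSet x′ (B n ∸ i)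
      diagonal (inj₁ t) = <⇒≱ (≤-trans ℓ<y′ (m≤n+m _ x′)) t
        where
        ℓ<y′ : ℓ < B n ∸ i
        ℓ<y′ = subst (ℓ <_) (sym y′≡) (≤-trans (m≤n+m (suc ℓ) n) (m≤n+m _ x′))
      diagonal (inj₂ (inj₁ (m , Am≡x′ , Bm≡y′))) =
        <-irrefl (trans (sym Am≡x′) (cong A m≡n)) (∸-<-self 1≤i i≤A)
        where
        m≡n : m ≡ n
        m≡n = +-cancelʳ-≡ (suc ℓ) m n (+-cancelˡ-≡ x′ (m + suc ℓ) (n + suc ℓ)
                (trans (cong (_+ (m + suc ℓ)) (sym Am≡x′)) (trans (sym (B≡A+n+ℓ+1 m)) (trans Bm≡y′ y′≡))))
      diagonal (inj₂ (inj₂ (m , Bm≡x′ , Am≡y′))) =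
        <⇒≱ (A<B m) (subst₂ _≤_ (sym Bm≡x′) (sym (trans Am≡y′ y′≡)) (m≤m+n x′ (n + suc ℓ)))

  WythoffSet-stable : ∀ {x y x′ y′} → WythoffSet x y → Move ℓ x y x′ y′ → ¬ WythoffSet x′ y′
  WythoffSet-stable (inj₁ t) mv = contradiction t (<⇒≱ (move-nonterminal mv))
  WythoffSet-stable (inj₂ (inj₁ (n , refl , refl))) mv = stable-AB n mv
  WythoffSet-stable (inj₂ (inj₂ (n , refl , refl))) mv s = stable-AB n (move-swap mv) (WythoffSet-swap s)

  MoveInto : ℕ → ℕ → Set
  MoveInto x y = ∃₂ λ x′ y′ → Move ℓ x y x′ y′ × WythoffSet x′ y′

  private
    down-to : ∀ {x y y′} → ℓ < x + y → y′ < y → Move ℓ x y x y′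
    down-to {x} {y} {y′} nt y′<y = subst (Move ℓ x y x) (m∸[m∸n]≡n (<⇒≤ y′<y))
      (down (y ∸ y′) nt (m<n⇒0<n∸m y′<y) (m∸n≤m y y′))

    -- From (A n , y) with A n ≤ y < B n the difference d = y - A n is at most ℓ (go to
    -- (0 , d)) or equals m + ℓ + 1 = B m - A m for some m < n (go to (A m , B m)).
    diagonal-move : ∀ n {y} → A n ≤ y → y < B n → ℓ < A n + y → MoveInto (A n) y
    diagonal-move n {y} x≤y y<Bn nt with y ∸ A n ≤? ℓ
    ... | yes d≤ℓ = A n ∸ A n , y ∸ A n , diag (A n) nt (≤-trans (s≤s z≤n) (ℓ<A n)) ≤-refl x≤y ,
                    inj₁ (subst (λ z → z + (y ∸ A n) ≤ ℓ) (sym (n∸n≡0 (A n))) d≤ℓ)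
    ... | no d≰ℓ = A m , B m , subst₂ (Move ℓ (A n) y) x∸j≡Am y∸j≡Bm (diag j nt 1≤j j≤x (≤-trans j≤x x≤y)) ,
                   inj₂ (inj₁ (m , refl , refl))
      where
      d = y ∸ A n
      m = d ∸ suc ℓ
      d≡m+ℓ+1 : d ≡ m + suc ℓ
      d≡m+ℓ+1 = sym (m∸n+n≡m (≰⇒> d≰ℓ))
      m<n : m < n
      m<n = +-cancelʳ-< (suc ℓ) m n (subst (_< n + suc ℓ) d≡m+ℓ+1 (+-cancelˡ-< (A n) d (n + suc ℓ)
              (subst₂ _<_ (sym (m+[n∸m]≡n x≤y)) (B≡A+n+ℓ+1 n) y<Bn)))
      Am<An : A m < A n
      Am<An = A.mono-< m<n
      j = A n ∸ A m
      1≤j : 1 ≤ j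
      1≤j = m<n⇒0<n∸m Am<An
      j≤x : j ≤ A n
      j≤x = m∸n≤m (A n) (A m)
      x∸j≡Am : A n ∸ j ≡ A m
      x∸j≡Am = m∸[m∸n]≡n (<⇒≤ Am<An)
      y∸j≡Bm : y ∸ j ≡ B m
      y∸j≡Bm = begin
        y ∸ j              ≡⟨ cong (_∸ j) (sym (m+[n∸m]≡n x≤y)) ⟩
        (A n + d) ∸ j      ≡⟨ +-∸-comm d j≤x ⟩
        (A n ∸ j) + d      ≡⟨ cong₂ _+_ x∸j≡Am d≡m+ℓ+1 ⟩
        A m + (m + suc ℓ)  ≡⟨ sym (B≡A+n+ℓ+1 m) ⟩
        B m                ∎

    or-move-≤ : ∀ {x y} → x ≤ y → WythoffSet x y ⊎ MoveInto x y
    or-move-≤ {x} {y} x≤y with x + y ≤? ℓ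
    ... | yes t = inj₁ (inj₁ t)
    ... | no t≰ = or-move-nonterminal (≰⇒> t≰)
      where
      or-move-nonterminal : ℓ < x + y → WythoffSet x y ⊎ MoveInto x y
      or-move-nonterminal nt with x ≤? ℓ
      ... | yes x≤ℓ = inj₂ (x , 0 , down-to nt 0<y , inj₁ (subst (_≤ ℓ) (sym (+-identityʳ x)) x≤ℓ))
        where
        0<y : 0 < y
        0<y = ≰⇒> λ y≤0 → t≰ (subst (λ z → x + z ≤ ℓ) (sym (n≤0⇒n≡0 y≤0))
                                     (subst (_≤ ℓ) (sym (+-identityʳ x)) x≤ℓ))
      ... | no x≰ℓ with A⊎B x (≰⇒> x≰ℓ)
      ...   | inj₂ (n , refl) = inj₂ (B n , A n , down-to nt (<-≤-trans (A<B n) x≤y) , inj₂ (inj₂ (n , refl , refl)))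
      ...   | inj₁ (n , refl) with <-cmp y (B n)
      ...     | tri≈ _ y≡Bn _ = inj₁ (inj₂ (inj₁ (n , refl , sym y≡Bn)))
      ...     | tri> _ _ Bn<y = inj₂ (A n , B n , down-to nt Bn<y , inj₂ (inj₁ (n , refl , refl)))
      ...     | tri< y<Bn _ _ = inj₂ (diagonal-move n x≤y y<Bn nt)

  WythoffSet-or-move : ∀ x y → WythoffSet x y ⊎ MoveInto x y
  WythoffSet-or-move x y with x ≤? y
  ... | yes x≤y = or-move-≤ x≤y
  ... | no x≰y with or-move-≤ (<⇒≤ (≰⇒> x≰y))
  ...   | inj₁ s = inj₁ (WythoffSet-swap s)
  ...   | inj₂ (y′ , x′ , mv , s) = inj₂ (x′ , y′ , move-swap mv , WythoffSet-swap s)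

  wythoffPair⇒listsPPositions : ListsPPositions ℓ A B
  wythoffPair⇒listsPPositions = pairs-are-P , P-are-pairs , A-<
    where
    open Kernel WythoffSet WythoffSet-stable WythoffSet-or-move

    pairs-are-P : ∀ n → (A n < B n) × NonTerminalP ℓ (A n) (B n)
    pairs-are-P n = A<B n , <-≤-trans (ℓ<B n) (m≤n+m (B n) (A n)) , S⇒IsP (inj₂ (inj₁ (n , refl , refl)))

    P-are-pairs : ∀ x y → x < y → NonTerminalP ℓ x y → ∃ λ n → A n ≡ x × B n ≡ y
    P-are-pairs x y x<y (nt , p) with IsP⇒S p
    ... | inj₁ t = contradiction t (<⇒≱ nt)
    ... | inj₂ (inj₁ pair) = pair
    ... | inj₂ (inj₂ (n , refl , refl)) = contradiction x<y (<⇒≯ (A<B n))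

-- Inserting digits before the end of a Zeckendorf word

α : List Bool → List Bool
α [] = []
α (d ∷ []) = false ∷ d ∷ []
α (d ∷ u@(_ ∷ _)) = d ∷ α u

β : List Bool → List Bool
β [] = true ∷ false ∷ []
β (d ∷ []) = d ∷ not d ∷ d ∷ []
β (d ∷ u@(_ ∷ _)) = d ∷ β u

α-∷ʳ : ∀ u d → α (u ∷ʳ d) ≡ u ∷ʳ false ∷ʳ d
α-∷ʳ [] d = refl
α-∷ʳ (x ∷ []) d = refl
α-∷ʳ (x ∷ y ∷ u) d = cong (x ∷_) (α-∷ʳ (y ∷ u) d)

β-∷ʳ-false : ∀ u → β (u ∷ʳ false) ≡ u ∷ʳ false ∷ʳ true ∷ʳ false
β-∷ʳ-false [] = refl
β-∷ʳ-false (x ∷ []) = refl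
β-∷ʳ-false (x ∷ y ∷ u) = cong (x ∷_) (β-∷ʳ-false (y ∷ u))

β-∷ʳ-true : ∀ u → β (u ∷ʳ true) ≡ u ∷ʳ true ∷ʳ false ∷ʳ true
β-∷ʳ-true [] = refl
β-∷ʳ-true (x ∷ []) = refl
β-∷ʳ-true (x ∷ y ∷ u) = cong (x ∷_) (β-∷ʳ-true (y ∷ u))

length-α-∷ : ∀ d u → length (α (d ∷ u)) ≡ suc (suc (length u))
length-α-∷ d [] = refl
length-α-∷ d (e ∷ u) = cong suc (length-α-∷ e u)

length-β-∷ : ∀ d u → length (β (d ∷ u)) ≡ suc (suc (suc (length u)))
length-β-∷ d [] = refl
length-β-∷ d (e ∷ u) = cong suc (length-β-∷ e u)

val-α-0∷ : LeadingZerosIrrelevant (val ∘′ α)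
val-α-0∷ [] = refl
val-α-0∷ (_ ∷ _) = refl

val-β-0∷ : LeadingZerosIrrelevant (val ∘′ β)
val-β-0∷ [] = refl
val-β-0∷ (_ ∷ _) = refl

val-β : ∀ u → val (β u) ≡ val (α u) + val u + 2
val-β [] = refl
val-β (false ∷ []) = refl
val-β (true ∷ []) = refl
val-β (false ∷ u@(_ ∷ _)) = val-β u
val-β (true ∷ u@(e ∷ v)) = begin
  F (length (β u)) + val (β u)
    ≡⟨ cong₂ _+_ (cong F (length-β-∷ e v)) (val-β u) ⟩
  F (suc (suc (suc (length v)))) + (x + y + 2)
    ≡⟨ solve 4 (λ p q x y → (p :+ q) :+ (x :+ y :+ con 2) := p :+ x :+ (q :+ y) :+ con 2) refl
         (F (suc (suc (length v)))) (F (suc (length v))) x y ⟩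
  F (suc (suc (length v))) + x + (F (suc (length v)) + y) + 2
    ≡⟨ cong (λ l → F l + x + (F (suc (length v)) + y) + 2) (sym (length-α-∷ e v)) ⟩
  F (length (α u)) + x + (F (length u) + y) + 2 ∎
  where
  open +-*-Solver
  x = val (α u)
  y = val u

zeckendorf-α : ∀ {u} → Zeckendorf u → Zeckendorf (α u)
zeckendorf-α {u} z with reverseView u
... | [] = []
... | v ∶ _ ∶ʳ false = subst Zeckendorf (sym (α-∷ʳ v false)) (zeckendorf-∷ʳ-false z)
... | v ∶ _ ∶ʳ true = subst Zeckendorf (sym (α-∷ʳ v true))
        (zeckendorf-∷ʳ-01 v (zeckendorf-∷ʳ-false (zeckendorf-∷ʳ⁻ v z)))

zeckendorf-β : ∀ {u} → Zeckendorf u → Zeckendorf (β u)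
zeckendorf-β {u} z with reverseView u
... | [] = 10∷ []
... | v ∶ _ ∶ʳ false = subst Zeckendorf (sym (β-∷ʳ-false v)) (zeckendorf-∷ʳ-false (zeckendorf-∷ʳ-01 v z))
... | v ∶ _ ∶ʳ true = subst Zeckendorf (sym (β-∷ʳ-true v)) (zeckendorf-∷ʳ-01 (v ∷ʳ true) (zeckendorf-∷ʳ-false z))

val-α<F : ∀ {u} → Zeckendorf u → val (α u) < F (suc (length u))
val-α<F {[]} _ = s≤s z≤n
val-α<F {d ∷ u} z = subst (λ l → val (α (d ∷ u)) < F l) (length-α-∷ d u) (val<F (zeckendorf-α z))

val-α-10∷ : ∀ u → val (α (true ∷ false ∷ u)) ≡ F (suc (suc (length u))) + val (α u)
val-α-10∷ u = cong₂ _+_ (cong F (length-α-∷ false u)) (val-α-0∷ u)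

-- Among Zeckendorf words of equal length the value order is lexicographic, and α
-- inserts its 0 at the same place in both words.
α-<-mono : ∀ {u v} → Zeckendorf u → Zeckendorf v → length u ≡ length v →
           val u < val v → val (α u) < val (α v)
α-<-mono (0∷_ {u} zu) (0∷_ {v} zv) eq u<v =
  subst₂ _<_ (sym (val-α-0∷ u)) (sym (val-α-0∷ v)) (α-<-mono zu zv (suc-injective eq) u<v)
α-<-mono (0∷ []) 1∷[] _ _ = s≤s z≤n
α-<-mono (0∷_ {u} zu) (10∷_ {v} _) eq _ =
  subst₂ _<_ (sym (val-α-0∷ u)) (sym (val-α-10∷ v)) (<-≤-trans αu<F (m≤m+n _ (val (α v))))
  where
  αu<F : val (α u) < F (suc (suc (length v)))
  αu<F = subst (λ l → val (α u) < F (suc l)) (suc-injective eq) (val-α<F zu)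
α-<-mono 1∷[] (0∷ []) _ ()
α-<-mono 1∷[] 1∷[] _ 1<1 = contradiction 1<1 (<-irrefl refl)
α-<-mono (10∷_ {u} _) (0∷_ {v} zv) eq 10u<0v = contradiction 10u<0v (≤⇒≯ (<⇒≤ (<-≤-trans v<F (m≤m+n _ (val u)))))
  where
  v<F : val v < F (suc (length u))
  v<F = subst (λ l → val v < F l) (sym (suc-injective eq)) (val<F zv)
α-<-mono (10∷_ {u} zu) (10∷_ {v} zv) eq 10u<10v =
  subst₂ _<_ (sym (val-α-10∷ u)) (sym (val-α-10∷ v))
    (subst (λ l → F (suc (suc (length u))) + val (α u) < F (suc (suc l)) + val (α v)) |u|≡|v|
      (+-monoʳ-< _ (α-<-mono zu zv |u|≡|v| u<v)))
  where
  |u|≡|v| : length u ≡ length v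
  |u|≡|v| = suc-injective (suc-injective eq)
  u<v : val u < val v
  u<v = +-cancelˡ-< (F (suc (length u))) _ _
          (subst (λ l → F (suc (length u)) + val u < F (suc l) + val v) (sym |u|≡|v|) 10u<10v)

αβ-Preimage : List Bool → Set
αβ-Preimage w = ∃ λ u → Zeckendorf u × (val (α u) ≡ val w ⊎ val (β u) ≡ val w)

α-preimage : ∀ {u w} → Zeckendorf u → α u ≡ w → αβ-Preimage w
α-preimage {u} z eq = u , z , inj₁ (cong val eq)

β-preimage : ∀ {u w} → Zeckendorf u → β u ≡ w → αβ-Preimage w
β-preimage {u} z eq = u , z , inj₂ (cong val eq)

αβ-preimage-01 : ∀ {v} → Reverse v → Zeckendorf (v ∷ʳ false ∷ʳ true) → αβ-Preimage (v ∷ʳ false ∷ʳ true)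
αβ-preimage-01 [] _ = α-preimage 1∷[] refl
αβ-preimage-01 (v ∶ _ ∶ʳ false) z =
  α-preimage (zeckendorf-∷ʳ-01 v (zeckendorf-∷ʳ⁻ _ (zeckendorf-∷ʳ⁻ _ z))) (α-∷ʳ (v ∷ʳ false) true)
αβ-preimage-01 (v ∶ _ ∶ʳ true) z = β-preimage (zeckendorf-∷ʳ⁻ _ (zeckendorf-∷ʳ⁻ _ z)) (β-∷ʳ-true v)

αβ-preimage-10 : ∀ {v} → Reverse v → Zeckendorf (v ∷ʳ true ∷ʳ false) → αβ-Preimage (v ∷ʳ true ∷ʳ false)
αβ-preimage-10 [] _ = β-preimage [] refl
αβ-preimage-10 (v ∶ _ ∶ʳ false) z = β-preimage (zeckendorf-∷ʳ⁻ _ (zeckendorf-∷ʳ⁻ _ z)) (β-∷ʳ-false v)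
αβ-preimage-10 (v ∶ _ ∶ʳ true) z = contradiction (zeckendorf-∷ʳ⁻ _ z) (zeckendorf-∷ʳ-11 v)

αβ-preimage-∷ʳ : ∀ {v} → Reverse v → ∀ d → Zeckendorf (v ∷ʳ d) → αβ-Preimage (v ∷ʳ d)
αβ-preimage-∷ʳ [] d z = [ d ] , z , inj₁ refl
αβ-preimage-∷ʳ (v ∶ _ ∶ʳ false) false z = α-preimage (zeckendorf-∷ʳ⁻ _ z) (α-∷ʳ v false)
αβ-preimage-∷ʳ (_ ∶ rv ∶ʳ false) true z = αβ-preimage-01 rv z
αβ-preimage-∷ʳ (_ ∶ rv ∶ʳ true) false z = αβ-preimage-10 rv z
αβ-preimage-∷ʳ (v ∶ _ ∶ʳ true) true z = contradiction z (zeckendorf-∷ʳ-11 v)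

αβ-preimage : ∀ {w} → Zeckendorf w → αβ-Preimage w
αβ-preimage {w} z with reverseView w
... | [] = α-preimage [] refl
... | _ ∶ rv ∶ʳ d = αβ-preimage-∷ʳ rv d z

-- The morphism f₁

-- δ₁ s d is letter d of f₁ s.  For the one-letter images f₁ c1 and f₁ c4 the value at
-- true is arbitrary, since Zeckendorf words never contain 11.
δ₁ : L5 → Bool → L5
δ₁ c0 false = c0
δ₁ c0 true = c1
δ₁ c1 false = c2
δ₁ c1 true = c1
δ₁ c2 false = c3
δ₁ c2 true = c4
δ₁ c3 false = c3
δ₁ c3 true = c1
δ₁ c4 false = c2
δ₁ c4 true = c4

one?₁ : L5 → Bool
one?₁ c1 = true
one?₁ c4 = true
one?₁ _ = false

f₁-δ₁ : ∀ s → f₁ s ≡ δ₁ s false ∷ (if one?₁ s then [] else [ δ₁ s true ])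
f₁-δ₁ c0 = refl
f₁-δ₁ c1 = refl
f₁-δ₁ c2 = refl
f₁-δ₁ c3 = refl
f₁-δ₁ c4 = refl

one?₁-δ₁ : ∀ s d → one?₁ (δ₁ s d) ≡ d
one?₁-δ₁ c0 false = refl
one?₁-δ₁ c0 true = refl
one?₁-δ₁ c1 false = refl
one?₁-δ₁ c1 true = refl
one?₁-δ₁ c2 false = refl
one?₁-δ₁ c2 true = refl
one?₁-δ₁ c3 false = refl
one?₁-δ₁ c3 true = refl
one?₁-δ₁ c4 false = refl
one?₁-δ₁ c4 true = refl

open FibonacciAutomaton f₁ δ₁ one?₁ f₁-δ₁ one?₁-δ₁

iterF₁-iterate : ∀ k → iterF₁ k ≡ iterate k [ c0 ]
iterF₁-iterate zero = refl
iterF₁-iterate (suc k) = cong (concatMap f₁) (iterF₁-iterate k)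

fixF₁-generates : Generates c0 fixF₁
fixF₁-generates {u} z = trans (cong (λ xs → fromMaybe c0 (lookupM xs (val u))) (iterF₁-iterate (suc (val u))))
                              (fixedPoint-generates refl refl z)

f₁-isPhiMorphism : IsPhiMorphism f₁ fixF₁
f₁-isPhiMorphism = generates⇒isPhiMorphism refl refl fixF₁-generates

coded-val : ∀ {u} → Zeckendorf u → coded (2 + val u) ≡ g₁ (run c0 u)
coded-val z = cong g₁ (fixF₁-generates z)

g₁-δ₁-00 : ∀ s → g₁ (δ₁ (δ₁ s false) false) ≡ a
g₁-δ₁-00 c0 = refl
g₁-δ₁-00 c1 = refl
g₁-δ₁-00 c2 = refl
g₁-δ₁-00 c3 = refl
g₁-δ₁-00 c4 = refl

g₁-δ₁-01 : ∀ s → one?₁ s ≡ false → g₁ (δ₁ (δ₁ s false) true) ≡ a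
g₁-δ₁-01 c0 _ = refl
g₁-δ₁-01 c2 _ = refl
g₁-δ₁-01 c3 _ = refl

δ₁-10 : ∀ s → δ₁ (δ₁ s true) false ≡ c2
δ₁-10 c0 = refl
δ₁-10 c1 = refl
δ₁-10 c2 = refl
δ₁-10 c3 = refl
δ₁-10 c4 = refl

g₁-run-α : ∀ {u} → Zeckendorf u → g₁ (run c0 (α u)) ≡ a
g₁-run-α {u} z with reverseView u
... | [] = refl
... | v ∶ _ ∶ʳ false rewrite α-∷ʳ v false | run-∷ʳ² c0 v false false = g₁-δ₁-00 (run c0 v)
... | v ∶ _ ∶ʳ true rewrite α-∷ʳ v true | run-∷ʳ² c0 v false true =
  g₁-δ₁-01 (run c0 v) (trans (one?-run refl refl v) (zeckendorf-∷ʳ-true⁻ v z))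

g₁-run-β : ∀ u → g₁ (run c0 (β u)) ≡ b
g₁-run-β u with reverseView u
... | [] = refl
... | v ∶ _ ∶ʳ false rewrite β-∷ʳ-false v | run-∷ʳ² c0 (v ∷ʳ false) true false | δ₁-10 (run c0 (v ∷ʳ false)) = refl
... | v ∶ _ ∶ʳ true rewrite β-∷ʳ-true v | run-∷ʳ c0 (v ∷ʳ true ∷ʳ false) true | run-∷ʳ² c0 v true false
                          | δ₁-10 (run c0 v) = refl

isOcc-enumeration : ∀ {c} {e : ℕ → ℕ} → (∀ n → e n < e (suc n)) → (∀ n → coded (2 + e n) ≡ c) →
                    (∀ {m} → coded (2 + m) ≡ c → ∃ λ n → e n ≡ m) → ∀ n → IsOcc c n (2 + e n)
isOcc-enumeration {c} {e} e-< hit onto n =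
  s≤s (s≤s z≤n) , hit n ,
  trans (length-filter-map (λ j → coded j ≟AB c) (2 +_) (upTo (e n)))
        (count-enumeration (λ j → coded (2 + j) ≟AB c) e-< hit onto n)

aSeq : ℕ → ℕ
aSeq n = 2 + val (α (repF n))

bSeq : ℕ → ℕ
bSeq n = 2 + val (β (repF n))

coded-aSeq : ∀ n → coded (aSeq n) ≡ a
coded-aSeq n = trans (coded-val (zeckendorf-α (repF-zeckendorf n))) (g₁-run-α (repF-zeckendorf n))

coded-bSeq : ∀ n → coded (bSeq n) ≡ b
coded-bSeq n = trans (coded-val (zeckendorf-β (repF-zeckendorf n))) (g₁-run-β (repF n))

bSeq≡aSeq+n+2 : ∀ n → bSeq n ≡ aSeq n + (n + 2)
bSeq≡aSeq+n+2 n = cong (2 +_) (begin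
  val (β (repF n))                             ≡⟨ val-β (repF n) ⟩
  val (α (repF n)) + val (repF n) + 2          ≡⟨ cong (λ m → val (α (repF n)) + m + 2) (val-repF n) ⟩
  val (α (repF n)) + n + 2                     ≡⟨ +-assoc (val (α (repF n))) n 2 ⟩
  val (α (repF n)) + (n + 2)                   ∎)

val-α-repF : ∀ {u} → Zeckendorf u → val (α (repF (val u))) ≡ val (α u)
val-α-repF {u} z = zeckendorf-unique val-α-0∷ (repF-zeckendorf (val u)) z (val-repF (val u))

val-β-repF : ∀ {u} → Zeckendorf u → val (β (repF (val u))) ≡ val (β u)
val-β-repF {u} z = zeckendorf-unique val-β-0∷ (repF-zeckendorf (val u)) z (val-repF (val u))

val-α-repF-< : ∀ n → val (α (repF n)) < val (α (repF (suc n)))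
val-α-repF-< n = subst (_< val (α (repF (suc n)))) (sym (zeckendorf-unique val-α-0∷ (repF-zeckendorf n) zn val-n))
  (α-<-mono zn (repF-zeckendorf (suc n)) (trans (length-greedy k n) (sym (length-greedy k (suc n))))
    (subst₂ _<_ (sym (val-greedy k n n<Fk)) (sym (val-repF (suc n))) (n<1+n n)))
  where
  k = fibLen (suc n)
  n<Fk : n < F k
  n<Fk = <-trans (n<1+n n) (n<F[fibLen] (suc n))
  zn : Zeckendorf (greedy k n)
  zn = greedy-zeckendorf k n n<Fk
  val-n : val (repF n) ≡ val (greedy k n)
  val-n = trans (val-repF n) (sym (val-greedy k n n<Fk))

aSeq⊎bSeq : ∀ m → (∃ λ n → aSeq n ≡ 2 + m) ⊎ (∃ λ n → bSeq n ≡ 2 + m)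
aSeq⊎bSeq m with αβ-preimage (repF-zeckendorf m)
... | u , z , inj₁ αu≡m = inj₁ (val u , cong (2 +_) (trans (val-α-repF z) (trans αu≡m (val-repF m))))
... | u , z , inj₂ βu≡m = inj₂ (val u , cong (2 +_) (trans (val-β-repF z) (trans βu≡m (val-repF m))))

aSeq≢bSeq : ∀ m n → aSeq m ≢ bSeq n
aSeq≢bSeq m n eq with trans (sym (coded-aSeq m)) (trans (cong coded eq) (coded-bSeq n))
... | ()

wythoffPair : WythoffPair 1 aSeq bSeq
wythoffPair = record
  { A-<       = λ n → +-monoʳ-< 2 (val-α-repF-< n)
  ; ℓ<A       = λ _ → s≤s (s≤s z≤n)
  ; B≡A+n+ℓ+1 = bSeq≡aSeq+n+2
  ; A≢B       = aSeq≢bSeq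
  ; A⊎B       = λ { (suc (suc m)) _ → aSeq⊎bSeq m ; (suc zero) (s≤s ()) }
  }

val-β-repF-< : ∀ n → val (β (repF n)) < val (β (repF (suc n)))
val-β-repF-< n = +-cancelˡ-< 2 _ _ (B-< wythoffPair n)

a-occurrences : ∀ {m} → coded (2 + m) ≡ a → ∃ λ n → val (α (repF n)) ≡ m
a-occurrences {m} hit with aSeq⊎bSeq m
... | inj₁ (n , eq) = n , +-cancelˡ-≡ 2 _ _ eq
... | inj₂ (n , eq) = contradiction (trans (sym hit) (trans (cong coded (sym eq)) (coded-bSeq n))) λ ()

b-occurrences : ∀ {m} → coded (2 + m) ≡ b → ∃ λ n → val (β (repF n)) ≡ m
b-occurrences {m} hit with aSeq⊎bSeq m
... | inj₁ (n , eq) = contradiction (trans (sym hit) (trans (cong coded (sym eq)) (coded-aSeq n))) λ ()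
... | inj₂ (n , eq) = n , +-cancelˡ-≡ 2 _ _ eq

proposition22 : IsPhiMorphism f₁ fixF₁
    × Σ (ℕ → ℕ) (λ A → Σ (ℕ → ℕ) (λ B →
        (∀ n → IsOcc a n (A n) × IsOcc b n (B n)) × ListsPPositions 1 A B))
proposition22 =
  f₁-isPhiMorphism , aSeq , bSeq ,
  (λ n → isOcc-enumeration val-α-repF-< coded-aSeq a-occurrences n ,
         isOcc-enumeration val-β-repF-< coded-bSeq b-occurrences n) ,
  wythoffPair⇒listsPPositions wythoffPair
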